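{- Let $\lambda$ be a nonzero real number. For every integer $n\ge1$, \[ G_{n,\lambda}=\lambda^{n-1}(1)_{n,1/\lambda}. \]
   Context: For a nonzero real $\mu$, set $(x)_{0,\mu}=1$ and $(x)_{n,\mu}=x(x-\mu)\cdots(x-(n-1)\mu)$ for $n\ge1$. Let $e_\lambda^x(t)=\sum_{n\ge0}(x)_{n,\lambda}\frac{t^n}{n!}=(1+\lambda t)^{x/\lambda}$ and $\log_\lambda(1+t)=\frac{1}{\lambda}((1+t)^\lambda-1)$ (the compositional inverse of $e_\lambda(t)=e_\lambda^1(t)$). The Gaenari polynomials are defined by $e_\lambda^x\big(\log_\lambda(\log_\lambda(1+t)+1)\big)=\sum_{n\ge0}G_{n,\lambda}(x)\frac{t^n}{n!}$, and the Gaenari numbers are $G_{n,\lambda}=G_{n,\lambda}(1)$. -}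

module Defs where

open import Level using (Level; _⊔_) renaming (suc to lsuc)
open import Algebra.Bundles using (CommutativeRing)
open import Data.Nat.Base using (ℕ; zero; suc; _∸_; _!; NonZero)
open import Data.Nat.Properties using (_!≢0)
open import Relation.Nullary using (¬_)

-- A field of characteristic zero: a commutative ring (with setoid equality ≈)
-- in which every nonzero element has a multiplicative inverse and no positive
-- integer multiple of 1 vanishes.  (The real numbers are an instance.)
-- the image of a natural number in a ring: n ↦ 1 + 1 + ... + 1
module RingFromℕ {c ℓ : Level} (R : CommutativeRing c ℓ) where
  open CommutativeRing R hiding (zero)
  fromℕ : ℕ → Carrier
  fromℕ zero    = 0#
  fromℕ (suc n) = 1# + fromℕ n

record CharZeroField (c ℓ : Level) : Set (lsuc (c ⊔ ℓ)) where
  field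
    commutativeRing : CommutativeRing c ℓ
  open CommutativeRing commutativeRing public hiding (zero)
  open RingFromℕ commutativeRing public
  field
    inv      : (x : Carrier) → ¬ (x ≈ 0#) → Carrier
    inv-law  : (x : Carrier) (p : ¬ (x ≈ 0#)) → x * inv x p ≈ 1#
    charZero : (n : ℕ) → .{{_ : NonZero n}} → ¬ (fromℕ n ≈ 0#)

module Gaenari {c ℓ : Level} (F : CharZeroField c ℓ) where
  open CharZeroField F

  pow : Carrier → ℕ → Carrier
  pow x zero    = 1#
  pow x (suc n) = x * pow x n

  falling : Carrier → Carrier → ℕ → Carrier
  falling x μ zero    = 1#
  falling x μ (suc n) = falling x μ n * (x - fromℕ n * μ)

  invFact : ℕ → Carrier
  invFact n = inv (fromℕ (n !)) (charZero (n !) {{n !≢0}})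

  PS : Set c
  PS = ℕ → Carrier

  sumTo : (ℕ → Carrier) → ℕ → Carrier
  sumTo f zero    = f zero
  sumTo f (suc n) = sumTo f n + f (suc n)

  oneS : PS
  oneS zero    = 1#
  oneS (suc n) = 0#

  _⊕_ : PS → PS → PS
  (f ⊕ g) n = f n + g n

  _⊖_ : PS → PS → PS
  (f ⊖ g) n = f n - g n

  scale : Carrier → PS → PS
  scale a f n = a * f n

  _⊛_ : PS → PS → PS
  (f ⊛ g) n = sumTo (λ k → f k * g (n ∸ k)) n

  powS : PS → ℕ → PS
  powS f zero    = oneS
  powS f (suc m) = f ⊛ powS f m

  -- composition f(g(t)), for g with zero constant term:
  -- [t^n] f(g(t)) = Σ_{m=0}^{n} f_m [t^n] g(t)^m
  _∘S_ : PS → PS → PS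
  (f ∘S g) n = sumTo (λ m → f m * powS g m n) n

  eS : (μ x : Carrier) → PS
  eS μ x n = falling x μ n * invFact n

  -- log_λ(1+t) = (1/λ) ((1+t)^λ - 1), with (1+t)^λ = e_1^λ(t)
  logS : (lam : Carrier) → ¬ (lam ≈ 0#) → PS
  logS lam p = scale (inv lam p) (eS 1# lam ⊖ oneS)

  -- Gaenari polynomials:
  -- e_λ^x(log_λ(log_λ(1+t)+1)) = Σ_n G_{n,λ}(x) t^n / n!
  G : (lam : Carrier) → ¬ (lam ≈ 0#) → ℕ → Carrier → Carrier
  G lam p n x = fromℕ (n !) * (eS lam x ∘S (logS lam p ∘S logS lam p)) n

  Gnum : (lam : Carrier) → ¬ (lam ≈ 0#) → ℕ → Carrier
  Gnum lam p n = G lam p n 1#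

-- Since e_λ and log_λ are compositional inverses, e_λ(log_λ(1 + Y)) = 1 + Y for every series Y
-- without constant term; for Y = log_λ(1 + t) the generating function of the Gaenari numbers is
-- therefore 1 + log_λ(1 + t), whose n-th coefficient is (λ)_{n,1} / (λ n!) = λ^{n-1} (1)_{n,1/λ} / n!.
-- To avoid proving associativity of composition, the inverse identity is obtained from uniqueness
-- of solutions of first-order differential equations: with M = log_λ(1 + Y), both U = e_λ(M) and
-- U = 1 + Y solve (1 + λ M) U′ = U M′ with U(0) = 1.
module Submission where

open import Defs
open import Level using (Level)
open import Data.Nat.Base using (ℕ; zero; suc; _≤_; _<_; _∸_; _!; z≤n; s≤s)
  renaming (_+_ to _+ℕ_; _*_ to _*ℕ_)
import Data.Nat.Properties as ℕ
open import Data.Sum.Base using (inj₁; inj₂)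
open import Data.Maybe.Base using (nothing)
open import Relation.Nullary using (¬_)
import Relation.Binary.PropositionalEquality as ≡
import Relation.Binary.Reasoning.Setoid as SetoidReasoning
import Algebra.Properties.Ring as RingProperties
import Algebra.Properties.CommutativeSemigroup as CommutativeSemigroupProperties
import Algebra.Solver.Ring.NaturalCoefficients as NaturalCoefficientsSolver

module GaenariProperties {c ℓ : Level} (F : CharZeroField c ℓ) where
  open CharZeroField F
  open Gaenari F
  open RingProperties ring using (+-cancelˡ; -0#≈0#; -‿distribʳ-*; //-rightDividesˡ)
  open CommutativeSemigroupProperties *-commutativeSemigroup
    using (x∙yz≈y∙xz; x∙yz≈yx∙z; xy∙z≈xz∙y)
  open CommutativeSemigroupProperties +-commutativeSemigroup
    using () renaming (interchange to +-interchange)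
  open NaturalCoefficientsSolver commutativeSemiring (λ _ _ → nothing)
  open SetoidReasoning setoid

  fromℕ-+ : ∀ m n → fromℕ (m +ℕ n) ≈ fromℕ m + fromℕ n
  fromℕ-+ zero    n = sym (+-identityˡ _)
  fromℕ-+ (suc m) n = trans (+-congˡ (fromℕ-+ m n)) (sym (+-assoc _ _ _))

  fromℕ-* : ∀ m n → fromℕ (m *ℕ n) ≈ fromℕ m * fromℕ n
  fromℕ-* zero    n = sym (zeroˡ _)
  fromℕ-* (suc m) n = begin
    fromℕ (n +ℕ m *ℕ n)          ≈⟨ fromℕ-+ n (m *ℕ n) ⟩
    fromℕ n + fromℕ (m *ℕ n)     ≈⟨ +-congˡ (fromℕ-* m n) ⟩
    fromℕ n + fromℕ m * fromℕ n  ≈⟨ solve 2 (λ a b → b :+ a :* b := (con 1 :+ a) :* b) refl _ _ ⟩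
    (1# + fromℕ m) * fromℕ n     ∎

  x-0≈x : ∀ x → x - 0# ≈ x
  x-0≈x x = trans (+-congˡ -0#≈0#) (+-identityʳ x)

  *-distribˡ-sub : ∀ a x y → a * (x - y) ≈ a * x - a * y
  *-distribˡ-sub a x y = trans (distribˡ a x (- y)) (+-congˡ (sym (-‿distribʳ-* a y)))

  module _ {x : Carrier} (x≉0 : ¬ (x ≈ 0#)) where

    inv-*-cancel : ∀ y → inv x x≉0 * (x * y) ≈ y
    inv-*-cancel y = begin
      inv x x≉0 * (x * y)  ≈⟨ *-assoc _ _ _ ⟨
      (inv x x≉0 * x) * y  ≈⟨ *-congʳ (trans (*-comm _ _) (inv-law x x≉0)) ⟩
      1# * y               ≈⟨ *-identityˡ y ⟩
      y                    ∎

    *-inv-cancel : ∀ y → x * (inv x x≉0 * y) ≈ y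
    *-inv-cancel y = trans (x∙yz≈y∙xz _ _ _) (inv-*-cancel y)

    *-cancelˡ-≉0 : ∀ {y z} → x * y ≈ x * z → y ≈ z
    *-cancelˡ-≉0 {y} {z} xy≈xz = begin
      y                    ≈⟨ inv-*-cancel y ⟨
      inv x x≉0 * (x * y)  ≈⟨ *-congˡ xy≈xz ⟩
      inv x x≉0 * (x * z)  ≈⟨ inv-*-cancel z ⟩
      z                    ∎

    inv-unique : ∀ {y} → x * y ≈ 1# → y ≈ inv x x≉0
    inv-unique xy≈1 = *-cancelˡ-≉0 (trans xy≈1 (sym (inv-law x x≉0)))

  invFact-zero : invFact 0 ≈ 1#
  invFact-zero = sym (inv-unique _ (trans (*-identityʳ _) (+-identityʳ 1#)))

  fromℕ-suc*invFact-suc : ∀ n → fromℕ (suc n) * invFact (suc n) ≈ invFact n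
  fromℕ-suc*invFact-suc n = inv-unique _ (begin
    fromℕ (n !) * (fromℕ (suc n) * invFact (suc n))  ≈⟨ x∙yz≈yx∙z _ _ _ ⟩
    (fromℕ (suc n) * fromℕ (n !)) * invFact (suc n)  ≈⟨ *-congʳ (fromℕ-* (suc n) (n !)) ⟨
    fromℕ (suc n !) * invFact (suc n)                ≈⟨ inv-law _ _ ⟩
    1#                                               ∎)

  sumTo-cong≤ : ∀ {f g : ℕ → Carrier} n → (∀ k → k ≤ n → f k ≈ g k) → sumTo f n ≈ sumTo g n
  sumTo-cong≤ zero    f≈g = f≈g 0 z≤n
  sumTo-cong≤ (suc n) f≈g =
    +-cong (sumTo-cong≤ n (λ k k≤n → f≈g k (ℕ.m≤n⇒m≤1+n k≤n))) (f≈g (suc n) ℕ.≤-refl)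

  sumTo-cong : ∀ {f g : ℕ → Carrier} n → (∀ k → f k ≈ g k) → sumTo f n ≈ sumTo g n
  sumTo-cong n f≈g = sumTo-cong≤ n (λ k _ → f≈g k)

  sumTo-vanishing : ∀ (f : ℕ → Carrier) n → (∀ k → k ≤ n → f k ≈ 0#) → sumTo f n ≈ 0#
  sumTo-vanishing f zero    f≈0 = f≈0 0 z≤n
  sumTo-vanishing f (suc n) f≈0 = trans
    (+-cong (sumTo-vanishing f n (λ k k≤n → f≈0 k (ℕ.m≤n⇒m≤1+n k≤n))) (f≈0 (suc n) ℕ.≤-refl))
    (+-identityʳ 0#)

  sumTo-+ : ∀ (f g : ℕ → Carrier) n → sumTo (λ k → f k + g k) n ≈ sumTo f n + sumTo g n
  sumTo-+ f g zero    = refl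
  sumTo-+ f g (suc n) = trans (+-congʳ (sumTo-+ f g n)) (+-interchange _ _ _ _)

  *-distribˡ-sumTo : ∀ a (f : ℕ → Carrier) n → a * sumTo f n ≈ sumTo (λ k → a * f k) n
  *-distribˡ-sumTo a f zero    = refl
  *-distribˡ-sumTo a f (suc n) = trans (distribˡ a _ _) (+-congʳ (*-distribˡ-sumTo a f n))

  *-distribʳ-sumTo : ∀ a (f : ℕ → Carrier) n → sumTo f n * a ≈ sumTo (λ k → f k * a) n
  *-distribʳ-sumTo a f zero    = refl
  *-distribʳ-sumTo a f (suc n) = trans (distribʳ a _ _) (+-congʳ (*-distribʳ-sumTo a f n))

  sumTo-head : ∀ (f : ℕ → Carrier) n → sumTo f (suc n) ≈ f 0 + sumTo (λ k → f (suc k)) n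
  sumTo-head f zero    = refl
  sumTo-head f (suc n) = trans (+-congʳ (sumTo-head f n)) (+-assoc _ _ _)

  sumTo-reverse : ∀ (f : ℕ → Carrier) n → sumTo f n ≈ sumTo (λ k → f (n ∸ k)) n
  sumTo-reverse f zero    = refl
  sumTo-reverse f (suc n) = begin
    sumTo f n + f (suc n)                  ≈⟨ +-congʳ (sumTo-reverse f n) ⟩
    sumTo (λ k → f (n ∸ k)) n + f (suc n)  ≈⟨ +-comm _ _ ⟩
    f (suc n) + sumTo (λ k → f (n ∸ k)) n  ≈⟨ sumTo-head (λ k → f (suc n ∸ k)) n ⟨
    sumTo (λ k → f (suc n ∸ k)) (suc n)    ∎

  sumTo-swap : ∀ (f : ℕ → ℕ → Carrier) m n →
    sumTo (λ i → sumTo (λ j → f i j) n) m ≈ sumTo (λ j → sumTo (λ i → f i j) m) n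
  sumTo-swap f zero    n = refl
  sumTo-swap f (suc m) n = trans (+-congʳ (sumTo-swap f m n))
    (sym (sumTo-+ (λ j → sumTo (λ i → f i j) m) (λ j → f (suc m) j) n))

  sumTo-trailing-zeros : ∀ (f : ℕ → Carrier) {m n} → m ≤ n →
    (∀ k → m < k → k ≤ n → f k ≈ 0#) → sumTo f n ≈ sumTo f m
  sumTo-trailing-zeros f {n = zero}  z≤n   _   = refl
  sumTo-trailing-zeros f {n = suc n} m≤1+n f≈0 with ℕ.m≤n⇒m<n∨m≡n m≤1+n
  ... | inj₂ ≡.refl     = refl
  ... | inj₁ (s≤s m≤n) = trans
    (+-cong (sumTo-trailing-zeros f m≤n (λ k m<k k≤n → f≈0 k m<k (ℕ.m≤n⇒m≤1+n k≤n)))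
            (f≈0 (suc n) (s≤s m≤n) ℕ.≤-refl))
    (+-identityʳ _)

  sumTo-triangle : ∀ (f : ℕ → ℕ → Carrier) n →
    sumTo (λ k → sumTo (λ j → f j k) k) n ≈ sumTo (λ j → sumTo (λ i → f j (j +ℕ i)) (n ∸ j)) n
  sumTo-triangle f zero    = refl
  sumTo-triangle f (suc n) = begin
    sumTo (λ k → sumTo (λ j → f j k) k) n + (sumTo (λ j → f j (suc n)) n + f (suc n) (suc n))
      ≈⟨ +-congʳ (sumTo-triangle f n) ⟩
    rows n + (sumTo (λ j → f j (suc n)) n + f (suc n) (suc n))
      ≈⟨ +-assoc _ _ _ ⟨
    (rows n + sumTo (λ j → f j (suc n)) n) + f (suc n) (suc n)
      ≈⟨ +-cong (sym (sumTo-+ _ _ n)) (reflexive (≡.cong (f (suc n)) (≡.sym (ℕ.+-identityʳ _)))) ⟩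
    sumTo (λ j → row j (n ∸ j) + f j (suc n)) n + f (suc n) (suc n +ℕ 0)
      ≈⟨ +-cong (sumTo-cong≤ n extend-row) (reflexive (≡.cong (row (suc n)) (≡.sym (ℕ.n∸n≡0 n)))) ⟩
    rows (suc n) ∎
    where
    row : ℕ → ℕ → Carrier
    row j = sumTo (λ i → f j (j +ℕ i))
    rows : ℕ → Carrier
    rows n = sumTo (λ j → row j (n ∸ j)) n
    extend-row : ∀ j → j ≤ n → row j (n ∸ j) + f j (suc n) ≈ row j (suc n ∸ j)
    extend-row j j≤n rewrite ℕ.+-∸-assoc 1 j≤n = +-congˡ (reflexive (≡.cong (f j)
      (≡.sym (≡.trans (ℕ.+-suc j (n ∸ j)) (≡.cong suc (ℕ.m+[n∸m]≡n j≤n))))))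

  infix 4 _≋_
  _≋_ : PS → PS → Set ℓ
  f ≋ g = ∀ n → f n ≈ g n

  ≋-refl : ∀ {f} → f ≋ f
  ≋-refl n = refl

  ≋-trans : ∀ {f g h} → f ≋ g → g ≋ h → f ≋ h
  ≋-trans f≋g g≋h n = trans (f≋g n) (g≋h n)

  ⊕-cong : ∀ {f f′ g g′} → f ≋ f′ → g ≋ g′ → (f ⊕ g) ≋ (f′ ⊕ g′)
  ⊕-cong f≋f′ g≋g′ n = +-cong (f≋f′ n) (g≋g′ n)

  scale-cong : ∀ a {f g} → f ≋ g → scale a f ≋ scale a g
  scale-cong a f≋g n = *-congˡ (f≋g n)

  scale-identity : ∀ f → scale 1# f ≋ f
  scale-identity f n = *-identityˡ (f n)

  ⊛-cong : ∀ {f f′ g g′} → f ≋ f′ → g ≋ g′ → (f ⊛ g) ≋ (f′ ⊛ g′)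
  ⊛-cong f≋f′ g≋g′ n = sumTo-cong n (λ k → *-cong (f≋f′ k) (g≋g′ (n ∸ k)))

  ⊛-congˡ : ∀ f {g g′} → g ≋ g′ → (f ⊛ g) ≋ (f ⊛ g′)
  ⊛-congˡ f = ⊛-cong {f = f} ≋-refl

  ⊛-congʳ : ∀ {f f′} g → f ≋ f′ → (f ⊛ g) ≋ (f′ ⊛ g)
  ⊛-congʳ g f≋f′ = ⊛-cong {g = g} f≋f′ ≋-refl

  ⊛-comm : ∀ f g → (f ⊛ g) ≋ (g ⊛ f)
  ⊛-comm f g n = begin
    sumTo (λ k → f k * g (n ∸ k)) n              ≈⟨ sumTo-reverse _ n ⟩
    sumTo (λ k → f (n ∸ k) * g (n ∸ (n ∸ k))) n  ≈⟨ sumTo-cong≤ n swap ⟩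
    sumTo (λ k → g k * f (n ∸ k)) n              ∎
    where
    swap : ∀ k → k ≤ n → f (n ∸ k) * g (n ∸ (n ∸ k)) ≈ g k * f (n ∸ k)
    swap k k≤n rewrite ℕ.m∸[m∸n]≡n k≤n = *-comm _ _

  ⊛-assoc : ∀ f g h → ((f ⊛ g) ⊛ h) ≋ (f ⊛ (g ⊛ h))
  ⊛-assoc f g h n = begin
    sumTo (λ k → sumTo (λ j → f j * g (k ∸ j)) k * h (n ∸ k)) n
      ≈⟨ sumTo-cong n (λ k → *-distribʳ-sumTo (h (n ∸ k)) _ k) ⟩
    sumTo (λ k → sumTo (λ j → (f j * g (k ∸ j)) * h (n ∸ k)) k) n
      ≈⟨ sumTo-triangle (λ j k → (f j * g (k ∸ j)) * h (n ∸ k)) n ⟩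
    sumTo (λ j → sumTo (λ i → (f j * g ((j +ℕ i) ∸ j)) * h (n ∸ (j +ℕ i))) (n ∸ j)) n
      ≈⟨ sumTo-cong n (λ j → trans (sumTo-cong (n ∸ j) (reindex j)) (sym (*-distribˡ-sumTo (f j) _ (n ∸ j)))) ⟩
    sumTo (λ j → f j * sumTo (λ i → g i * h (n ∸ j ∸ i)) (n ∸ j)) n
      ∎
    where
    reindex : ∀ j i → (f j * g ((j +ℕ i) ∸ j)) * h (n ∸ (j +ℕ i)) ≈ f j * (g i * h (n ∸ j ∸ i))
    reindex j i rewrite ℕ.m+n∸m≡n j i | ≡.sym (ℕ.∸-+-assoc n j i) = *-assoc _ _ _

  ⊛-distribʳ : ∀ f g h → ((f ⊕ g) ⊛ h) ≋ ((f ⊛ h) ⊕ (g ⊛ h))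
  ⊛-distribʳ f g h n = trans (sumTo-cong n (λ k → distribʳ (h (n ∸ k)) (f k) (g k))) (sumTo-+ _ _ n)

  ⊛-scaleˡ : ∀ a f g → (scale a f ⊛ g) ≋ scale a (f ⊛ g)
  ⊛-scaleˡ a f g n = trans (sumTo-cong n (λ k → *-assoc a (f k) (g (n ∸ k)))) (sym (*-distribˡ-sumTo a _ n))

  ⊛-scaleʳ : ∀ a f g → (f ⊛ scale a g) ≋ scale a (f ⊛ g)
  ⊛-scaleʳ a f g n =
    trans (⊛-comm f (scale a g) n) (trans (⊛-scaleˡ a g f n) (*-congˡ (⊛-comm g f n)))

  ⊛-identityˡ : ∀ f → (oneS ⊛ f) ≋ f
  ⊛-identityˡ f zero    = *-identityˡ _
  ⊛-identityˡ f (suc n) = begin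
    sumTo (λ k → oneS k * f (suc n ∸ k)) (suc n)
      ≈⟨ sumTo-head _ n ⟩
    1# * f (suc n) + sumTo (λ k → 0# * f (n ∸ k)) n
      ≈⟨ +-cong (*-identityˡ _) (sumTo-vanishing _ n (λ k _ → zeroˡ _)) ⟩
    f (suc n) + 0#
      ≈⟨ +-identityʳ _ ⟩
    f (suc n)
      ∎

  ⊛-identityʳ : ∀ f → (f ⊛ oneS) ≋ f
  ⊛-identityʳ f n = trans (⊛-comm f oneS n) (⊛-identityˡ f n)

  oneS⊕scale-⊛ : ∀ a g h → ((oneS ⊕ scale a g) ⊛ h) ≋ (h ⊕ scale a (g ⊛ h))
  oneS⊕scale-⊛ a g h n =
    trans (⊛-distribʳ oneS (scale a g) h n) (+-cong (⊛-identityˡ h n) (⊛-scaleˡ a g h n))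

  ∂ : PS → PS
  ∂ f n = fromℕ (suc n) * f (suc n)

  t·_ : PS → PS
  (t· f) zero    = 0#
  (t· f) (suc n) = f n

  ∂-cong : ∀ {f g} → f ≋ g → ∂ f ≋ ∂ g
  ∂-cong f≋g n = *-congˡ (f≋g (suc n))

  t·-cong : ∀ {f g} → f ≋ g → t· f ≋ t· g
  t·-cong f≋g zero    = refl
  t·-cong f≋g (suc n) = f≋g n

  ∂-scale : ∀ a f → ∂ (scale a f) ≋ scale a (∂ f)
  ∂-scale a f n = x∙yz≈y∙xz _ _ _

  t·-scale : ∀ a f → t· (scale a f) ≋ scale a (t· f)
  t·-scale a f zero    = sym (zeroʳ a)
  t·-scale a f (suc n) = refl

  ∂-⊖oneS : ∀ f → ∂ (f ⊖ oneS) ≋ ∂ f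
  ∂-⊖oneS f n = *-congˡ (x-0≈x _)

  ∂-oneS⊕ : ∀ f → ∂ (oneS ⊕ f) ≋ ∂ f
  ∂-oneS⊕ f n = *-congˡ (+-identityˡ _)

  ∂-⊛ : ∀ f g → ∂ (f ⊛ g) ≋ ((∂ f ⊛ g) ⊕ (f ⊛ ∂ g))
  ∂-⊛ f g n = begin
    fromℕ (suc n) * sumTo term (suc n)
      ≈⟨ *-distribˡ-sumTo _ term (suc n) ⟩
    sumTo (λ k → fromℕ (suc n) * term k) (suc n)
      ≈⟨ sumTo-cong≤ (suc n) split ⟩
    sumTo (λ k → fromℕ k * term k + fromℕ (suc n ∸ k) * term k) (suc n)
      ≈⟨ sumTo-+ _ _ (suc n) ⟩
    sumTo (λ k → fromℕ k * term k) (suc n) + sumTo (λ k → fromℕ (suc n ∸ k) * term k) (suc n)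
      ≈⟨ +-cong ∂f-part f∂-part ⟩
    (∂ f ⊛ g) n + (f ⊛ ∂ g) n
      ∎
    where
    term : ℕ → Carrier
    term k = f k * g (suc n ∸ k)
    split : ∀ k → k ≤ suc n → fromℕ (suc n) * term k ≈ fromℕ k * term k + fromℕ (suc n ∸ k) * term k
    split k k≤ = trans (*-congʳ (trans (reflexive (≡.cong fromℕ (≡.sym (ℕ.m+[n∸m]≡n k≤))))
                                       (fromℕ-+ k (suc n ∸ k))))
                       (distribʳ _ _ _)
    ∂f-part : sumTo (λ k → fromℕ k * term k) (suc n) ≈ (∂ f ⊛ g) n
    ∂f-part = begin
      sumTo (λ k → fromℕ k * term k) (suc n)
        ≈⟨ sumTo-head _ n ⟩
      0# * term 0 + sumTo (λ k → fromℕ (suc k) * (f (suc k) * g (n ∸ k))) n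
        ≈⟨ +-cong (zeroˡ _) (sumTo-cong n (λ k → sym (*-assoc _ _ _))) ⟩
      0# + (∂ f ⊛ g) n
        ≈⟨ +-identityˡ _ ⟩
      (∂ f ⊛ g) n
        ∎
    last-vanishes : fromℕ (n ∸ n) * term (suc n) ≈ 0#
    last-vanishes rewrite ℕ.n∸n≡0 n = zeroˡ _
    inner : ∀ k → k ≤ n → fromℕ (suc n ∸ k) * term k ≈ f k * ∂ g (n ∸ k)
    inner k k≤n rewrite ℕ.+-∸-assoc 1 k≤n = x∙yz≈y∙xz _ _ _
    f∂-part : sumTo (λ k → fromℕ (suc n ∸ k) * term k) (suc n) ≈ (f ⊛ ∂ g) n
    f∂-part = trans (+-cong (sumTo-cong≤ n inner) last-vanishes) (+-identityʳ _)

  powS-vanishing : ∀ {g} → g 0 ≈ 0# → ∀ m k → k < m → powS g m k ≈ 0#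
  powS-vanishing {g} g₀≈0 (suc m) k (s≤s k≤m) = sumTo-vanishing _ k term≈0
    where
    term≈0 : ∀ j → j ≤ k → g j * powS g m (k ∸ j) ≈ 0#
    term≈0 zero    _ = trans (*-congʳ g₀≈0) (zeroˡ _)
    term≈0 (suc j) (s≤s {n = k′} j≤k′) = trans
      (*-congˡ (powS-vanishing g₀≈0 m (k′ ∸ j) (ℕ.≤-trans (s≤s (ℕ.m∸n≤m k′ j)) k≤m)))
      (zeroʳ _)

  ∂-powS : ∀ g m → ∂ (powS g (suc m)) ≋ scale (fromℕ (suc m)) (powS g m ⊛ ∂ g)
  ∂-powS g zero n = begin
    ∂ (g ⊛ oneS) n              ≈⟨ ∂-cong (⊛-identityʳ g) n ⟩
    ∂ g n                       ≈⟨ ⊛-identityˡ (∂ g) n ⟨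
    (oneS ⊛ ∂ g) n              ≈⟨ *-identityˡ _ ⟨
    1# * (oneS ⊛ ∂ g) n         ≈⟨ *-congʳ (+-identityʳ 1#) ⟨
    (1# + 0#) * (oneS ⊛ ∂ g) n  ∎
  ∂-powS g (suc m) n = begin
    ∂ (g ⊛ gᵐ⁺¹) n
      ≈⟨ ∂-⊛ g gᵐ⁺¹ n ⟩
    (∂ g ⊛ gᵐ⁺¹) n + (g ⊛ ∂ gᵐ⁺¹) n
      ≈⟨ +-cong (⊛-comm (∂ g) gᵐ⁺¹ n) (⊛-congˡ g (∂-powS g m) n) ⟩
    (gᵐ⁺¹ ⊛ ∂ g) n + (g ⊛ scale cₘ (powS g m ⊛ ∂ g)) n
      ≈⟨ +-congˡ (⊛-scaleʳ cₘ g (powS g m ⊛ ∂ g) n) ⟩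
    (gᵐ⁺¹ ⊛ ∂ g) n + cₘ * (g ⊛ (powS g m ⊛ ∂ g)) n
      ≈⟨ +-congˡ (*-congˡ (⊛-assoc g (powS g m) (∂ g) n)) ⟨
    (gᵐ⁺¹ ⊛ ∂ g) n + cₘ * (gᵐ⁺¹ ⊛ ∂ g) n
      ≈⟨ solve 2 (λ x c → x :+ c :* x := (con 1 :+ c) :* x) refl _ _ ⟩
    (1# + cₘ) * (gᵐ⁺¹ ⊛ ∂ g) n
      ∎
    where
    gᵐ⁺¹ : PS
    gᵐ⁺¹ = powS g (suc m)
    cₘ : Carrier
    cₘ = fromℕ (suc m)

  ∘S-⊛ : ∀ f {g} q → g 0 ≈ 0# → ((f ∘S g) ⊛ q) ≋ (λ n → sumTo (λ m → f m * (powS g m ⊛ q) n) n)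
  ∘S-⊛ f {g} q g₀≈0 n = begin
    sumTo (λ k → sumTo (λ m → f m * powS g m k) k * q (n ∸ k)) n
      ≈⟨ sumTo-cong n (λ k → *-distribʳ-sumTo (q (n ∸ k)) _ k) ⟩
    sumTo (λ k → sumTo (λ m → term m k) k) n
      ≈⟨ sumTo-cong≤ n (λ k k≤n → sym (sumTo-trailing-zeros (λ m → term m k) k≤n (λ m k<m _ → term≈0 k<m))) ⟩
    sumTo (λ k → sumTo (λ m → term m k) n) n
      ≈⟨ sumTo-swap (λ k m → term m k) n n ⟩
    sumTo (λ m → sumTo (λ k → term m k) n) n
      ≈⟨ sumTo-cong n (λ m → trans (sumTo-cong n (λ k → *-assoc _ _ _)) (sym (*-distribˡ-sumTo _ _ n))) ⟩
    sumTo (λ m → f m * (powS g m ⊛ q) n) n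
      ∎
    where
    term : ℕ → ℕ → Carrier
    term m k = (f m * powS g m k) * q (n ∸ k)
    term≈0 : ∀ {m k} → k < m → term m k ≈ 0#
    term≈0 {m} {k} k<m = trans (*-congʳ (trans (*-congˡ (powS-vanishing g₀≈0 m k k<m)) (zeroʳ _))) (zeroˡ _)

  ∂-∘S : ∀ f {g} → g 0 ≈ 0# → ∂ (f ∘S g) ≋ ((∂ f ∘S g) ⊛ ∂ g)
  ∂-∘S f {g} g₀≈0 n = begin
    fromℕ (suc n) * sumTo (λ m → f m * powS g m (suc n)) (suc n)
      ≈⟨ *-distribˡ-sumTo _ _ (suc n) ⟩
    sumTo (λ m → fromℕ (suc n) * (f m * powS g m (suc n))) (suc n)
      ≈⟨ sumTo-head _ n ⟩
    fromℕ (suc n) * (f 0 * 0#) + sumTo (λ m → fromℕ (suc n) * (f (suc m) * powS g (suc m) (suc n))) n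
      ≈⟨ +-cong (trans (*-congˡ (zeroʳ _)) (zeroʳ _)) (sumTo-cong n (λ m → term m)) ⟩
    0# + sumTo (λ m → ∂ f m * (powS g m ⊛ ∂ g) n) n
      ≈⟨ +-identityˡ _ ⟩
    sumTo (λ m → ∂ f m * (powS g m ⊛ ∂ g) n) n
      ≈⟨ ∘S-⊛ (∂ f) (∂ g) g₀≈0 n ⟨
    ((∂ f ∘S g) ⊛ ∂ g) n
      ∎
    where
    term : ∀ m → fromℕ (suc n) * (f (suc m) * powS g (suc m) (suc n)) ≈ ∂ f m * (powS g m ⊛ ∂ g) n
    term m = trans (x∙yz≈y∙xz _ _ _) (trans (*-congˡ (∂-powS g m n)) (x∙yz≈yx∙z _ _ _))

  t·-∘S : ∀ h {g} → g 0 ≈ 0# → ((t· h) ∘S g) ≋ (g ⊛ (h ∘S g))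
  t·-∘S h {g} g₀≈0 n = begin
    ((t· h) ∘S g) n                         ≈⟨ shifted n ⟨
    sumTo (λ m → h m * (g ⊛ powS g m) n) n  ≈⟨ sumTo-cong n (λ m → *-congˡ (⊛-comm g (powS g m) n)) ⟩
    sumTo (λ m → h m * (powS g m ⊛ g) n) n  ≈⟨ ∘S-⊛ h g g₀≈0 n ⟨
    ((h ∘S g) ⊛ g) n                        ≈⟨ ⊛-comm (h ∘S g) g n ⟩
    (g ⊛ (h ∘S g)) n                        ∎
    where
    shifted : ∀ n → sumTo (λ m → h m * powS g (suc m) n) n ≈ ((t· h) ∘S g) n
    shifted zero    =
      trans (*-congˡ (powS-vanishing {g} g₀≈0 1 0 (s≤s z≤n))) (trans (zeroʳ _) (sym (zeroˡ _)))
    shifted (suc n) = begin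
      sumTo (λ m → h m * powS g (suc m) (suc n)) n + h (suc n) * powS g (suc (suc n)) (suc n)
        ≈⟨ +-congˡ (trans (*-congˡ (powS-vanishing g₀≈0 (suc (suc n)) (suc n) ℕ.≤-refl)) (zeroʳ _)) ⟩
      sumTo (λ m → h m * powS g (suc m) (suc n)) n + 0#
        ≈⟨ trans (+-identityʳ _) (sym (+-identityˡ _)) ⟩
      0# + sumTo (λ m → h m * powS g (suc m) (suc n)) n
        ≈⟨ +-congʳ (zeroˡ _) ⟨
      0# * powS g 0 (suc n) + sumTo (λ m → h m * powS g (suc m) (suc n)) n
        ≈⟨ sumTo-head _ n ⟨
      ((t· h) ∘S g) (suc n)
        ∎

  ∘S-cong : ∀ {f f′} g → f ≋ f′ → (f ∘S g) ≋ (f′ ∘S g)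
  ∘S-cong g f≋f′ n = sumTo-cong n (λ m → *-congʳ (f≋f′ m))

  ∘S-⊕ : ∀ f h g → ((f ⊕ h) ∘S g) ≋ ((f ∘S g) ⊕ (h ∘S g))
  ∘S-⊕ f h g n = trans (sumTo-cong n (λ m → distribʳ _ _ _)) (sumTo-+ _ _ n)

  ∘S-scale : ∀ a f g → (scale a f ∘S g) ≋ scale a (f ∘S g)
  ∘S-scale a f g n = trans (sumTo-cong n (λ m → *-assoc _ _ _)) (sym (*-distribˡ-sumTo a _ n))

  oneS-∘S : ∀ g → (oneS ∘S g) ≋ oneS
  oneS-∘S g zero    = *-identityˡ _
  oneS-∘S g (suc n) = begin
    (oneS ∘S g) (suc n)
      ≈⟨ sumTo-head _ n ⟩
    1# * 0# + sumTo (λ m → 0# * powS g (suc m) (suc n)) n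
      ≈⟨ +-cong (zeroʳ _) (sumTo-vanishing _ n (λ _ _ → zeroˡ _)) ⟩
    0# + 0#
      ≈⟨ +-identityʳ _ ⟩
    0#
      ∎

  ∘S-ode : ∀ a f {g} → g 0 ≈ 0# →
    (((∂ f ⊕ scale a (t· ∂ f)) ∘S g) ⊛ ∂ g) ≋ ((oneS ⊕ scale a g) ⊛ ∂ (f ∘S g))
  ∘S-ode a f {g} g₀≈0 n = begin
    (((∂ f ⊕ scale a (t· ∂ f)) ∘S g) ⊛ ∂ g) n   ≈⟨ ⊛-congʳ (∂ g) expand n ⟩
    ((∂f∘g ⊕ scale a (g ⊛ ∂f∘g)) ⊛ ∂ g) n       ≈⟨ ⊛-congʳ (∂ g) (oneS⊕scale-⊛ a g ∂f∘g) n ⟨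
    (((oneS ⊕ scale a g) ⊛ ∂f∘g) ⊛ ∂ g) n       ≈⟨ ⊛-assoc _ ∂f∘g (∂ g) n ⟩
    ((oneS ⊕ scale a g) ⊛ (∂f∘g ⊛ ∂ g)) n       ≈⟨ ⊛-congˡ (oneS ⊕ scale a g) (∂-∘S f g₀≈0) n ⟨
    ((oneS ⊕ scale a g) ⊛ ∂ (f ∘S g)) n         ∎
    where
    ∂f∘g : PS
    ∂f∘g = ∂ f ∘S g
    expand : ((∂ f ⊕ scale a (t· ∂ f)) ∘S g) ≋ (∂f∘g ⊕ scale a (g ⊛ ∂f∘g))
    expand = ≋-trans (∘S-⊕ _ _ g)
      (⊕-cong ≋-refl (≋-trans (∘S-scale a _ g) (scale-cong a (t·-∘S (∂ f) g₀≈0))))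

  ode-unique : ∀ (A B U V : PS) → A 0 ≈ 1# → (A ⊛ ∂ U) ≋ (U ⊛ B) → (A ⊛ ∂ V) ≋ (V ⊛ B) →
    U 0 ≈ V 0 → U ≋ V
  ode-unique A B U V A₀≈1 U-ode V-ode U₀≈V₀ n = agree n n ℕ.≤-refl
    where
    ∂⊛A-agree : ∀ n → (∀ j → j ≤ n → U j ≈ V j) → (∂ U ⊛ A) n ≈ (∂ V ⊛ A) n
    ∂⊛A-agree n U≈V = begin
      (∂ U ⊛ A) n  ≈⟨ ⊛-comm (∂ U) A n ⟩
      (A ⊛ ∂ U) n  ≈⟨ U-ode n ⟩
      (U ⊛ B) n    ≈⟨ sumTo-cong≤ n (λ k k≤n → *-congʳ (U≈V k k≤n)) ⟩
      (V ⊛ B) n    ≈⟨ V-ode n ⟨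
      (A ⊛ ∂ V) n  ≈⟨ ⊛-comm A (∂ V) n ⟩
      (∂ V ⊛ A) n  ∎
    cancel-leading : ∀ {n a} → a ≈ 1# → ∂ U n * a ≈ ∂ V n * a → U (suc n) ≈ V (suc n)
    cancel-leading {n} a≈1 eq = *-cancelˡ-≉0 (charZero (suc n))
      (trans (sym (*a≈ (∂ U n))) (trans eq (*a≈ (∂ V n))))
      where
      *a≈ : ∀ x → x * _ ≈ x
      *a≈ x = trans (*-congˡ a≈1) (*-identityʳ x)
    -- the last term of (∂ U ⊛ A) n is (n + 1) U (n + 1) A 0; the others involve only U 0, …, U n
    next : ∀ n → (∀ j → j ≤ n → U j ≈ V j) → U (suc n) ≈ V (suc n)
    next zero    U≈V = cancel-leading A₀≈1 (∂⊛A-agree 0 U≈V)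
    next (suc n) U≈V = cancel-leading (trans (reflexive (≡.cong A (ℕ.n∸n≡0 n))) A₀≈1)
      (+-cancelˡ _ _ _ (trans (+-congʳ (sym earlier-agree)) (∂⊛A-agree (suc n) U≈V)))
      where
      earlier-agree : sumTo (λ k → ∂ U k * A (suc n ∸ k)) n ≈ sumTo (λ k → ∂ V k * A (suc n ∸ k)) n
      earlier-agree = sumTo-cong≤ n (λ k k≤n → *-congʳ (*-congˡ (U≈V (suc k) (s≤s k≤n))))
    agree : ∀ n j → j ≤ n → U j ≈ V j
    agree zero    zero z≤n = U₀≈V₀
    agree (suc n) j j≤1+n with ℕ.m≤n⇒m<n∨m≡n j≤1+n
    ... | inj₁ (s≤s j≤n) = agree n j j≤n
    ... | inj₂ ≡.refl    = next n (agree n)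

  falling-cong : ∀ {x x′ μ μ′} → x ≈ x′ → μ ≈ μ′ → ∀ n → falling x μ n ≈ falling x′ μ′ n
  falling-cong x≈x′ μ≈μ′ zero    = refl
  falling-cong x≈x′ μ≈μ′ (suc n) =
    *-cong (falling-cong x≈x′ μ≈μ′ n) (+-cong x≈x′ (-‿cong (*-congˡ μ≈μ′)))

  falling-scale : ∀ a x μ n → falling (a * x) (a * μ) n ≈ pow a n * falling x μ n
  falling-scale a x μ zero    = sym (*-identityˡ 1#)
  falling-scale a x μ (suc n) = begin
    falling (a * x) (a * μ) n * (a * x - fromℕ n * (a * μ))
      ≈⟨ *-cong (falling-scale a x μ n) factor ⟩
    (pow a n * falling x μ n) * (a * (x - fromℕ n * μ))
      ≈⟨ solve 4 (λ a p f d → (p :* f) :* (a :* d) := (a :* p) :* (f :* d)) refl _ _ _ _ ⟩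
    (a * pow a n) * (falling x μ n * (x - fromℕ n * μ))
      ∎
    where
    factor : a * x - fromℕ n * (a * μ) ≈ a * (x - fromℕ n * μ)
    factor = trans (+-congˡ (-‿cong (x∙yz≈y∙xz _ _ _))) (sym (*-distribˡ-sub a x _))

  ∂-eS : ∀ μ x n → ∂ (eS μ x) n ≈ eS μ x n * (x - fromℕ n * μ)
  ∂-eS μ x n = begin
    fromℕ (suc n) * ((falling x μ n * d) * invFact (suc n))  ≈⟨ x∙yz≈y∙xz _ _ _ ⟩
    (falling x μ n * d) * (fromℕ (suc n) * invFact (suc n))  ≈⟨ *-congˡ (fromℕ-suc*invFact-suc n) ⟩
    (falling x μ n * d) * invFact n                          ≈⟨ xy∙z≈xz∙y _ _ _ ⟩
    eS μ x n * d                                             ∎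
    where
    d : Carrier
    d = x - fromℕ n * μ

  eS-ode : ∀ μ x → (∂ (eS μ x) ⊕ scale μ (t· ∂ (eS μ x))) ≋ scale x (eS μ x)
  eS-ode μ x n = begin
    ∂ (eS μ x) n + μ * (t· ∂ (eS μ x)) n
      ≈⟨ +-cong (∂-eS μ x n) (*-congˡ (t·∂eS n)) ⟩
    e * (x - fromℕ n * μ) + μ * (fromℕ n * e)
      ≈⟨ +-cong (*-distribˡ-sub e x _) (x∙yz≈yx∙z μ _ e) ⟩
    (e * x - e * (fromℕ n * μ)) + (fromℕ n * μ) * e
      ≈⟨ +-congˡ (*-comm _ e) ⟩
    (e * x - e * (fromℕ n * μ)) + e * (fromℕ n * μ)
      ≈⟨ //-rightDividesˡ _ _ ⟩
    e * x
      ≈⟨ *-comm e x ⟩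
    x * e
      ∎
    where
    e : Carrier
    e = eS μ x n
    t·∂eS : ∀ n → (t· ∂ (eS μ x)) n ≈ fromℕ n * eS μ x n
    t·∂eS zero    = sym (zeroˡ _)
    t·∂eS (suc n) = refl

  module _ {lam : Carrier} (lam≉0 : ¬ (lam ≈ 0#)) where

    private
      ι : Carrier
      ι = inv lam lam≉0
      B L : PS
      B = eS 1# lam
      L = logS lam lam≉0

    logS-zero : logS lam lam≉0 0 ≈ 0#
    logS-zero = trans (*-congˡ B₀-1≈0) (zeroʳ ι)
      where
      B₀-1≈0 : B 0 - 1# ≈ 0#
      B₀-1≈0 = trans (+-congʳ (trans (*-identityˡ _) invFact-zero)) (-‿inverseʳ 1#)

    ∂-logS : ∂ (logS lam lam≉0) ≋ scale (inv lam lam≉0) (∂ (eS 1# lam))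
    ∂-logS n = trans (∂-scale ι (B ⊖ oneS) n) (*-congˡ (∂-⊖oneS B n))

    logS-ode : (∂ L ⊕ scale 1# (t· ∂ L)) ≋ (oneS ⊕ scale lam L)
    logS-ode n = begin
      ∂ L n + 1# * (t· ∂ L) n
        ≈⟨ +-cong (∂-logS n) (*-congˡ (≋-trans (t·-cong ∂-logS) (t·-scale ι (∂ B)) n)) ⟩
      ι * ∂ B n + 1# * (ι * (t· ∂ B) n)  ≈⟨ +-congˡ (x∙yz≈y∙xz _ _ _) ⟩
      ι * ∂ B n + ι * (1# * (t· ∂ B) n)  ≈⟨ distribˡ ι _ _ ⟨
      ι * (∂ B n + 1# * (t· ∂ B) n)      ≈⟨ *-congˡ (eS-ode 1# lam n) ⟩
      ι * (lam * B n)                    ≈⟨ inv-*-cancel lam≉0 (B n) ⟩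
      B n                                ≈⟨ //-rightDividesˡ (oneS n) (B n) ⟨
      (B n - oneS n) + oneS n            ≈⟨ +-comm _ _ ⟩
      oneS n + (B n - oneS n)            ≈⟨ +-congˡ (*-inv-cancel lam≉0 _) ⟨
      oneS n + lam * L n                 ∎

    eS∘logS : ∀ {Y} → Y 0 ≈ 0# → (eS lam 1# ∘S (logS lam lam≉0 ∘S Y)) ≋ (oneS ⊕ Y)
    eS∘logS {Y} Y₀≈0 = ode-unique A (∂ M) H K A₀≈1 H-ode K-ode H₀≈K₀
      where
      E M H K A : PS
      E = eS lam 1#
      M = L ∘S Y
      H = E ∘S M
      K = oneS ⊕ Y
      A = oneS ⊕ scale lam M
      M₀≈0 : M 0 ≈ 0#
      M₀≈0 = trans (*-congʳ logS-zero) (zeroˡ _)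
      A₀≈1 : A 0 ≈ 1#
      A₀≈1 = trans (+-congˡ (trans (*-congˡ M₀≈0) (zeroʳ _))) (+-identityʳ _)
      H₀≈K₀ : H 0 ≈ K 0
      H₀≈K₀ = trans (*-identityʳ _) (trans (*-identityˡ _) (trans invFact-zero
                (sym (trans (+-congˡ Y₀≈0) (+-identityʳ 1#)))))
      H-ode : (A ⊛ ∂ H) ≋ (H ⊛ ∂ M)
      H-ode n = begin
        (A ⊛ ∂ H) n
          ≈⟨ ∘S-ode lam E M₀≈0 n ⟨
        (((∂ E ⊕ scale lam (t· ∂ E)) ∘S M) ⊛ ∂ M) n
          ≈⟨ ⊛-congʳ (∂ M) (∘S-cong M (≋-trans (eS-ode lam 1#) (scale-identity E))) n ⟩
        (H ⊛ ∂ M) n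
          ∎
      K-ode : (A ⊛ ∂ K) ≋ (K ⊛ ∂ M)
      K-ode n = begin
        (A ⊛ ∂ K) n
          ≈⟨ ⊛-congˡ A (∂-oneS⊕ Y) n ⟩
        (A ⊛ ∂ Y) n
          ≈⟨ ⊛-congʳ (∂ Y) (≋-trans (∘S-⊕ oneS _ Y) (⊕-cong (oneS-∘S Y) (∘S-scale lam L Y))) n ⟨
        (((oneS ⊕ scale lam L) ∘S Y) ⊛ ∂ Y) n
          ≈⟨ ⊛-congʳ (∂ Y) (∘S-cong Y logS-ode) n ⟨
        (((∂ L ⊕ scale 1# (t· ∂ L)) ∘S Y) ⊛ ∂ Y) n
          ≈⟨ ∘S-ode 1# L Y₀≈0 n ⟩
        ((oneS ⊕ scale 1# Y) ⊛ ∂ M) n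
          ≈⟨ ⊛-congʳ (∂ M) (⊕-cong ≋-refl (scale-identity Y)) n ⟩
        (K ⊛ ∂ M) n
          ∎

    Gnum-suc : ∀ n → Gnum lam lam≉0 (suc n) ≈ inv lam lam≉0 * falling lam 1# (suc n)
    Gnum-suc n = begin
      fromℕ (N !) * (eS lam 1# ∘S (L ∘S L)) N
        ≈⟨ *-congˡ (eS∘logS logS-zero N) ⟩
      fromℕ (N !) * (0# + ι * (falling lam 1# N * invFact N - 0#))
        ≈⟨ *-congˡ (trans (+-identityˡ _) (*-congˡ (x-0≈x _))) ⟩
      fromℕ (N !) * (ι * (falling lam 1# N * invFact N))
        ≈⟨ solve 4 (λ a i f b → a :* (i :* (f :* b)) := (i :* f) :* (a :* b)) refl _ _ _ _ ⟩
      (ι * falling lam 1# N) * (fromℕ (N !) * invFact N)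
        ≈⟨ *-congˡ (inv-law _ _) ⟩
      (ι * falling lam 1# N) * 1#
        ≈⟨ *-identityʳ _ ⟩
      ι * falling lam 1# N
        ∎
      where
      N : ℕ
      N = suc n

corollary13 : {c ℓ : Level} (F : CharZeroField c ℓ) (lam : CharZeroField.Carrier F) (p : ¬ (CharZeroField._≈_ F lam (CharZeroField.0# F))) (n : ℕ) → 1 ≤ n → CharZeroField._≈_ F (Gaenari.Gnum F lam p n) (CharZeroField._*_ F (Gaenari.pow F lam (n ∸ 1)) (Gaenari.falling F (CharZeroField.1# F) (CharZeroField.inv F lam p) n))
corollary13 F lam p (suc n) (s≤s z≤n) = begin
  Gnum lam p (suc n)
    ≈⟨ Gnum-suc p n ⟩
  ι * falling lam 1# (suc n)
    ≈⟨ *-congˡ (falling-cong (sym (*-identityʳ lam)) (sym (inv-law lam p)) (suc n)) ⟩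
  ι * falling (lam * 1#) (lam * ι) (suc n)
    ≈⟨ *-congˡ (falling-scale lam 1# ι (suc n)) ⟩
  ι * ((lam * pow lam n) * falling 1# ι (suc n))
    ≈⟨ *-congˡ (*-assoc _ _ _) ⟩
  ι * (lam * (pow lam n * falling 1# ι (suc n)))
    ≈⟨ inv-*-cancel p _ ⟩
  pow lam n * falling 1# ι (suc n)
    ∎
  where
  open CharZeroField F
  open Gaenari F
  open GaenariProperties F
  open SetoidReasoning setoid
  ι : Carrier
  ι = inv lam p
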